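{- Let $G$ be a doubly homogeneously traceable graph of order $n$ and circumference $c$, and let $v$ be a vertex of degree $4$ in $G$. Let $G'$ be the graph obtained from $G$ by blowing up $v$ into $K_4$. Then $G'$ is also doubly homogeneously traceable. If moreover $v$ lies in a longest cycle of $G$ and $v$ lies in a clique of cardinality $4$ in $G$, then $G'$ has circumference $c+3$, and $G'$ contains a vertex $v'$ that lies in a longest cycle of $G'$ and also lies in a clique of cardinality $4$ in $G'$.
   Context: All graphs are finite and simple. For a vertex $v$, a $v$-path is a path with $v$ as an endpoint. A graph $G$ is doubly homogeneously traceable if for every vertex $v$ of $G$ there are two Hamilton $v$-paths $P$ and $Q$ such that the edge of $P$ incident to $v$ and the edge of $Q$ incident to $v$ are distinct. The circumference of a graph is the length of a longest cycle. If $v$ is a vertex of degree $d$ with neighborhood $N(v)$, blowing up $v$ into the complete graph $K_d$ means deleting $v$, adding a new complete graph on $d$ new vertices, and adding $d$ edges joining the vertices of this $K_d$ to the vertices of $N(v)$ so that these $d$ new edges form a matching (each new vertex joined to exactly one vertex of $N(v)$ and vice versa). A clique of cardinality $4$ is a set of $4$ pairwise adjacent vertices. -}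

module Defs where

open import Level using (0ℓ)
open import Data.Nat using (ℕ; _≤_; _+_)
open import Data.Fin using (Fin)
open import Data.List using (List; []; _∷_; _++_; [_]; length)
open import Data.List.Relation.Unary.Linked using (Linked)
open import Data.List.Relation.Unary.Unique.Propositional using (Unique)
open import Data.List.Membership.Propositional using (_∈_)
open import Data.Product using (Σ; ∃; _×_; _,_)
open import Data.Sum using (_⊎_; inj₁; inj₂)
open import Data.Empty using (⊥)
open import Relation.Nullary using (¬_)
open import Relation.Binary.PropositionalEquality using (_≡_; _≢_; refl; sym)
open import Function.Definitions using (Injective)
open import Function.Bundles using (_⇔_)

record Graph : Set₁ where
  field
    V      : Set
    _~_    : V → V → Set
    ~-sym  : ∀ {x y} → x ~ y → y ~ x
    ~-irr  : ∀ x → ¬ (x ~ x)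
open Graph public

module _ (G : Graph) where
  private
    _∼_ = _~_ G

  HamPathFrom : V G → V G → Set
  HamPathFrom v w = Σ (List (V G)) λ rest →
    let xs = v ∷ w ∷ rest in
    Unique xs × Linked _∼_ xs × (∀ x → x ∈ xs)

  -- Doubly homogeneously traceable: for every v, two Hamilton v-paths whose
  -- edges at v are distinct (equivalently: the second vertices differ).
  DHT : Set
  DHT = ∀ v → Σ (V G) λ w₁ → Σ (V G) λ w₂ →
          w₁ ≢ w₂ × HamPathFrom v w₁ × HamPathFrom v w₂

  -- A cycle x ∷ ys (listed once, closed by the edge last→x); its length is
  -- its number of vertices (= number of edges).
  IsCycle : List (V G) → Set
  IsCycle [] = ⊥
  IsCycle (x ∷ ys) = 3 ≤ length (x ∷ ys) × Unique (x ∷ ys)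
                     × Linked _∼_ ((x ∷ ys) ++ [ x ])

  LongestCycle : List (V G) → Set
  LongestCycle xs = IsCycle xs × (∀ ys → IsCycle ys → length ys ≤ length xs)

  Circumference : ℕ → Set
  Circumference c = (Σ (List (V G)) λ xs → IsCycle xs × length xs ≡ c)
                    × (∀ ys → IsCycle ys → length ys ≤ c)

  InLongestCycle : V G → Set
  InLongestCycle v = Σ (List (V G)) λ xs → LongestCycle xs × v ∈ xs

  InClique4 : V G → Set
  InClique4 v = Σ (Fin 4 → V G) λ f →
    (∀ i j → i ≢ j → f i ∼ f j) × ∃ λ i → f i ≡ v

  -- An enumeration of the neighbourhood of v by Fin d (so deg v = d).
  record NbhdEnum (v : V G) (d : ℕ) : Set where
    field
      nb     : Fin d → V G
      nb-inj : Injective _≡_ _≡_ nb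
      nb-nbh : ∀ u → (v ∼ u) ⇔ (∃ λ i → nb i ≡ u)
  open NbhdEnum public

  record Rest (v : V G) : Set where
    constructor rest
    field
      pt  : V G
      .ne : pt ≢ v
  open Rest public

  -- Blowing up v into K_d, new vertex i matched with neighbour nb e i.
  module Blow (v : V G) {d : ℕ} (e : NbhdEnum v d) where
    V' : Set
    V' = Rest v ⊎ Fin d

    E' : V' → V' → Set
    E' (inj₁ a) (inj₁ b) = pt a ∼ pt b
    E' (inj₂ i) (inj₂ j) = i ≢ j
    E' (inj₂ i) (inj₁ a) = nb e i ≡ pt a
    E' (inj₁ a) (inj₂ i) = nb e i ≡ pt a

    E'-sym : ∀ {x y} → E' x y → E' y x
    E'-sym {inj₁ a} {inj₁ b} p = ~-sym G p
    E'-sym {inj₂ i} {inj₂ j} p = λ q → p (sym q)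
    E'-sym {inj₂ i} {inj₁ a} p = p
    E'-sym {inj₁ a} {inj₂ i} p = p

    E'-irr : ∀ x → ¬ E' x x
    E'-irr (inj₁ a) = ~-irr G (pt a)
    E'-irr (inj₂ i) p = p refl

    graph : Graph
    graph = record { V = V' ; _~_ = E' ; ~-sym = λ {x} {y} → E'-sym {x} {y} ; ~-irr = E'-irr }

blowUp : (G : Graph) (v : V G) {d : ℕ} → NbhdEnum G v d → Graph
blowUp G v e = Blow.graph G v e

-- Hamilton paths: replacing v in a Hamilton path of G by a Hamilton path of K₄ between
-- the new vertices matched with v's neighbours on the path gives a Hamilton path of G′.
-- From an old vertex the first edge is inherited; from a new vertex i the two middle
-- vertices of the route can be taken in either order, giving two first edges.
-- Circumference: a longest cycle through v gains three vertices in the same way.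
-- Conversely, a cycle of G′ meets K₄ in runs of consecutive new vertices. A run between
-- two different old stretches has distinct ends, matched with vertices of those
-- stretches, so three runs would need five new vertices. With one run the old part
-- closes up through v to a cycle of G; with two runs the clique at v joins the two old
-- stretches, which again close up through v. Either way at most four new vertices
-- accompany fewer than c old ones.

module Submission where

open import Defs
open import Data.Nat using (ℕ; suc; _+_; _≤_; _<_; z≤n; s≤s)
open import Data.Nat.Properties using (≤-trans; ≤-antisym; ≤-reflexive; +-comm; +-suc; +-monoˡ-≤; +-monoʳ-≤; m≤m+n; module ≤-Reasoning)
open import Data.Nat.Tactic.RingSolver using (solve-∀)
open import Data.Fin using (Fin; zero; suc; _≟_)
open import Data.Fin.Properties using (all?; any?)
open import Data.List using (List; []; _∷_; _++_; [_]; length; map; reverse; allFin)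
open import Data.List.Properties using (++-assoc; length-++; length-++-comm; length-map; length-reverse; unfold-reverse; ∷-injective; ∷-injectiveˡ)
open import Data.List.Relation.Unary.Linked as Linked using (Linked; [-]; _∷_)
open import Data.List.Relation.Unary.Unique.Propositional using (Unique; []; _∷_)
import Data.List.Relation.Unary.Unique.Propositional.Properties as Unique
open import Data.List.Relation.Unary.Unique.DecPropositional (_≟_ {4}) using (unique?)
open import Data.List.Membership.DecPropositional (_≟_ {4}) using (_∈?_)
open import Data.List.Relation.Unary.All as All using (All; []; _∷_)
open import Data.List.Relation.Unary.All.Properties using (¬Any⇒All¬)
open import Data.List.Relation.Unary.Any using (here; there)
open import Data.List.Relation.Unary.Any.Properties using (reverse⁻)
open import Data.List.Relation.Binary.Disjoint.Propositional using (Disjoint)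
open import Data.List.Relation.Binary.Subset.Propositional using (_⊆_)
open import Data.List.Membership.Propositional using (_∈_; _∉_)
open import Data.List.Membership.Propositional.Properties using (∈-++⁺ˡ; ∈-++⁺ʳ; ∈-++⁻; ∈-∃++; ∈-map⁺; ∈-map⁻; ∈-allFin)
open import Data.Product using (Σ; ∃; ∃₂; _×_; _,_; proj₁; proj₂)
open import Data.Sum using (_⊎_; inj₁; inj₂; [_,_]′)
open import Data.Empty using (⊥; ⊥-elim; ⊥-elim-irr)
open import Data.Unit using (⊤; tt)
open import Relation.Nullary using (¬_; ¬?; yes; no)
open import Relation.Nullary.Decidable using (from-yes; _→-dec_)
open import Relation.Binary.PropositionalEquality using (_≡_; _≢_; ≢-sym; refl; sym; trans; cong; cong₂; subst; subst₂; module ≡-Reasoning)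
open import Function.Bundles using (_↔_; Equivalence)

+-interchange : ∀ a b c d → a + (b + (c + d)) ≡ (a + c) + (b + d)
+-interchange = solve-∀

≤4+<⇒≤+3 : ∀ {a b c} → a ≤ 4 → b < c → a + b ≤ c + 3
≤4+<⇒≤+3 {a} {b} {c} a≤4 b<c = begin
  a + b       ≤⟨ +-monoˡ-≤ b a≤4 ⟩
  3 + suc b   ≤⟨ +-monoʳ-≤ 3 b<c ⟩
  3 + c       ≡⟨ +-comm 3 c ⟩
  c + 3       ∎
  where open ≤-Reasoning

module _ {A : Set} where

  Unique-∷ : ∀ {x : A} {xs} → x ∉ xs → Unique xs → Unique (x ∷ xs)
  Unique-∷ x∉xs u = ¬Any⇒All¬ _ x∉xs ∷ u

  Unique-++⁻ : ∀ (xs : List A) {ys} → Unique (xs ++ ys) → Unique xs × Unique ys × Disjoint xs ys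
  Unique-++⁻ [] u = [] , u , λ { (() , _) }
  Unique-++⁻ (x ∷ xs) u@(_ ∷ u′) with Unique-++⁻ xs u′
  ... | uxs , uys , xs#ys =
    Unique-∷ (λ m → Unique.Unique[x∷xs]⇒x∉xs u (∈-++⁺ˡ m)) uxs , uys ,
    λ { (here refl , m) → Unique.Unique[x∷xs]⇒x∉xs u (∈-++⁺ʳ xs m) ; (there m , m′) → xs#ys (m , m′) }

  Disjoint⇒≢ : ∀ {xs ys : List A} {x y} → Disjoint xs ys → x ∈ xs → y ∈ ys → x ≢ y
  Disjoint⇒≢ xs#ys x∈xs y∈ys refl = xs#ys (x∈xs , y∈ys)

  Unique-++-comm : ∀ xs {ys : List A} → Unique (xs ++ ys) → Unique (ys ++ xs)
  Unique-++-comm xs u with Unique-++⁻ xs u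
  ... | uxs , uys , xs#ys = Unique.++⁺ uys uxs λ (m , m′) → xs#ys (m′ , m)

  Unique-reverse : ∀ {xs : List A} → Unique xs → Unique (reverse xs)
  Unique-reverse {[]} u = u
  Unique-reverse {x ∷ xs} u@(_ ∷ u′) = subst Unique (sym (unfold-reverse x xs))
    (Unique.++⁺ (Unique-reverse u′) ([] ∷ [])
      λ { (m , here refl) → Unique.Unique[x∷xs]⇒x∉xs u (reverse⁻ m) })

  Unique-length-≤ : ∀ {xs ys : List A} → Unique xs → xs ⊆ ys → length xs ≤ length ys
  Unique-length-≤ {[]} _ _ = z≤n
  Unique-length-≤ {x ∷ xs} u@(_ ∷ u′) xs⊆ys with ∈-∃++ (xs⊆ys (here refl))
  ... | ys₁ , ys₂ , refl = ≤-trans (s≤s (Unique-length-≤ u′ xs⊆ys₁++ys₂)) (≤-reflexive length-eq)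
    where
    xs⊆ys₁++ys₂ : xs ⊆ ys₁ ++ ys₂
    xs⊆ys₁++ys₂ {z} m with ∈-++⁻ ys₁ (xs⊆ys (there m))
    ... | inj₁ m₁ = ∈-++⁺ˡ m₁
    ... | inj₂ (here refl) = ⊥-elim (Unique.Unique[x∷xs]⇒x∉xs u m)
    ... | inj₂ (there m₂) = ∈-++⁺ʳ ys₁ m₂
    open ≡-Reasoning
    length-eq : suc (length (ys₁ ++ ys₂)) ≡ length (ys₁ ++ x ∷ ys₂)
    length-eq = begin
      suc (length (ys₁ ++ ys₂))        ≡⟨ cong suc (length-++ ys₁) ⟩
      suc (length ys₁ + length ys₂)    ≡⟨ sym (+-suc (length ys₁) _) ⟩
      length ys₁ + length (x ∷ ys₂)    ≡⟨ sym (length-++ ys₁) ⟩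
      length (ys₁ ++ x ∷ ys₂)          ∎

module _ {A : Set} (R : A → A → Set) where

  data Walk : A → A → List A → Set where
    stop : ∀ a → Walk a a [ a ]
    step : ∀ {a b c xs} → R a b → Walk b c xs → Walk a c (a ∷ xs)

module _ {A : Set} {R : A → A → Set} where

  walk-++ : ∀ {a b c d xs ys} → Walk R a b xs → R b c → Walk R c d ys → Walk R a d (xs ++ ys)
  walk-++ (stop a) r w = step r w
  walk-++ (step r′ w′) r w = step r′ (walk-++ w′ r w)

  walk-uncons : ∀ {a c x xs} → Walk R a c (a ∷ x ∷ xs) → R a x × Walk R x c (x ∷ xs)
  walk-uncons (step r w@(stop _)) = r , w
  walk-uncons (step r w@(step _ _)) = r , w

  walk-split : ∀ {a d} x xs y ys → Walk R a d (x ∷ xs ++ y ∷ ys) →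
               ∃ λ b → Walk R a b (x ∷ xs) × R b y × Walk R y d (y ∷ ys)
  walk-split x [] y ys w@(step _ _) = x , stop x , walk-uncons w
  walk-split x (x′ ∷ xs) y ys (step r w) with walk-split x′ xs y ys w
  ... | b , w₁ , r₁ , w₂ = b , step r w₁ , r₁ , w₂

  walk-split-++ : ∀ {a d} x xs ys y zs → Walk R a d ((x ∷ xs) ++ ys ++ y ∷ zs) →
                  ∃ λ b → Walk R a b ((x ∷ xs) ++ ys) × R b y × Walk R y d (y ∷ zs)
  walk-split-++ x xs ys y zs w =
    walk-split x (xs ++ ys) y zs (subst (Walk R _ _) (sym (++-assoc (x ∷ xs) ys (y ∷ zs))) w)

  walk-head∈ : ∀ {a b xs} → Walk R a b xs → a ∈ xs
  walk-head∈ (stop a) = here refl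
  walk-head∈ (step _ _) = here refl

  walk-last∈ : ∀ {a b xs} → Walk R a b xs → b ∈ xs
  walk-last∈ (stop a) = here refl
  walk-last∈ (step r w) = there (walk-last∈ w)

  Walk⇒Linked : ∀ {a b xs} → Walk R a b xs → Linked R xs
  Walk⇒Linked (stop a) = [-]
  Walk⇒Linked (step r (stop _)) = r ∷ [-]
  Walk⇒Linked (step r w@(step _ _)) = r ∷ Walk⇒Linked w

  Linked⇒Walk : ∀ {x xs} → Linked R (x ∷ xs) → ∃ λ b → Walk R x b (x ∷ xs)
  Linked⇒Walk {x} {[]} _ = x , stop x
  Linked⇒Walk {x} {y ∷ xs} (r ∷ l) with Linked⇒Walk l
  ... | b , w = b , step r w

  Linked-∷ʳ⇒Walk : ∀ {x y} ys → Linked R (x ∷ ys ++ [ y ]) → ∃ λ b → Walk R x b (x ∷ ys) × R b y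
  Linked-∷ʳ⇒Walk {x} [] (r ∷ _) = x , stop x , r
  Linked-∷ʳ⇒Walk (z ∷ ys) (r ∷ l) with Linked-∷ʳ⇒Walk ys l
  ... | b , w , r′ = b , step r w , r′

  walk-map : ∀ {B : Set} {S : B → B → Set} (f : A → B) → (∀ {x y} → R x y → S (f x) (f y)) →
             ∀ {a b xs} → Walk R a b xs → Walk S (f a) (f b) (map f xs)
  walk-map f g (stop a) = stop (f a)
  walk-map f g (step r w) = step (g r) (walk-map f g w)

  walk-reverse : (∀ {x y} → R x y → R y x) → ∀ {a b xs} → Walk R a b xs → Walk R b a (reverse xs)
  walk-reverse R-sym (stop a) = stop a
  walk-reverse R-sym (step {a} {xs = xs} r w) =
    subst (Walk R _ a) (sym (unfold-reverse a xs)) (walk-++ (walk-reverse R-sym w) (R-sym r) (stop a))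

module _ (G : Graph) where
  private
    _∼_ = _~_ G

  walk-close : ∀ {x b xs} → Walk _∼_ x b (x ∷ xs) → b ∼ x → Linked _∼_ (x ∷ xs ++ [ x ])
  walk-close {x} w r = Walk⇒Linked (walk-++ w r (stop x))

  HamList : List (V G) → Set
  HamList xs = Unique xs × Linked _∼_ xs × (∀ x → x ∈ xs)

  IsCycle-rotate : ∀ x xs y ys → IsCycle G (x ∷ xs ++ y ∷ ys) → IsCycle G (y ∷ ys ++ x ∷ xs)
  IsCycle-rotate x xs y ys (len , u , l) with Linked-∷ʳ⇒Walk (xs ++ y ∷ ys) l
  ... | _ , w , r with walk-split x xs y ys w
  ... | _ , w₁ , r₁ , w₂ =
    subst (3 ≤_) (length-++-comm (x ∷ xs) (y ∷ ys)) len ,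
    Unique-++-comm (x ∷ xs) u ,
    walk-close (walk-++ w₂ r w₁) r₁

  record Arc (v a b : V G) (X : List (V G)) : Set where
    field
      walk      : Walk _∼_ a b X
      start-adj : v ∼ a
      end-adj   : v ∼ b
      unique    : Unique X
      avoids    : v ∉ X
  open Arc

  Arc-reverse : ∀ {v a b X} → Arc v a b X → Arc v b a (reverse X)
  Arc-reverse A = record
    { walk = walk-reverse (~-sym G) (walk A) ; start-adj = end-adj A ; end-adj = start-adj A
    ; unique = Unique-reverse (unique A) ; avoids = λ m → avoids A (reverse⁻ m) }

  Arc-join : ∀ {v a b c d X Y} → Arc v a b X → Arc v c d Y → b ∼ c → Disjoint X Y → Arc v a d (X ++ Y)
  Arc-join {X = X} A B r X#Y = record
    { walk = walk-++ (walk A) r (walk B) ; start-adj = start-adj A ; end-adj = end-adj B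
    ; unique = Unique.++⁺ (unique A) (unique B) X#Y
    ; avoids = λ m → [ avoids A , avoids B ]′ (∈-++⁻ X m) }

  Arc⇒IsCycle : ∀ {v a b X} → Arc v a b X → 2 ≤ length X → IsCycle G (v ∷ X)
  Arc⇒IsCycle A len =
    s≤s len , Unique-∷ (avoids A) (unique A) , walk-close (step (start-adj A) (walk A)) (~-sym G (end-adj A))

  Arc-start∈ : ∀ {v a b X} → Arc v a b X → a ∈ X
  Arc-start∈ A = walk-head∈ (walk A)

  Arc-end∈ : ∀ {v a b X} → Arc v a b X → b ∈ X
  Arc-end∈ A = walk-last∈ (walk A)

  CyclesAtMost : ℕ → Set
  CyclesAtMost c = ∀ ys → IsCycle G ys → length ys ≤ c

  -- An arc of length 1 closes up only to a digon, hence the separate case.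
  Arc-length< : ∀ {c v a b X} → CyclesAtMost c → 3 ≤ c → Arc v a b X → length X < c
  Arc-length< bound c≥3 A with walk A
  ... | stop _ = ≤-trans (s≤s (s≤s z≤n)) c≥3
  ... | step _ (stop _) = bound _ (Arc⇒IsCycle A (s≤s (s≤s z≤n)))
  ... | step _ (step _ _) = bound _ (Arc⇒IsCycle A (s≤s (s≤s z≤n)))

  IsCycle⇒3≤length : ∀ {xs} → IsCycle G xs → 3 ≤ length xs
  IsCycle⇒3≤length {_ ∷ _} (len , _) = len

  LongestCycle-length : ∀ {c xs} → Circumference G c → LongestCycle G xs → length xs ≡ c
  LongestCycle-length ((xs₀ , cyc₀ , refl) , bound) (cyc , longest) = ≤-antisym (bound _ cyc) (longest xs₀ cyc₀)

  IsCycle-through : ∀ {xs v} → IsCycle G xs → v ∈ xs → ∃ λ Y → IsCycle G (v ∷ Y) × length (v ∷ Y) ≡ length xs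
  IsCycle-through cyc v∈xs with ∈-∃++ v∈xs
  ... | [] , B , refl = B , cyc , refl
  ... | a ∷ A , B , refl = B ++ a ∷ A , IsCycle-rotate a A _ B cyc , length-++-comm (_ ∷ B) (a ∷ A)

  Crossing : V G → V G → V G → V G → Set
  Crossing a₁ a₂ b₁ b₂ = a₁ ∼ b₁ ⊎ a₁ ∼ b₂ ⊎ a₂ ∼ b₁ ⊎ a₂ ∼ b₂

  Arc-join-crossing : ∀ {v a₁ a₂ b₁ b₂ X Y} → Arc v a₁ a₂ X → Arc v b₁ b₂ Y → Disjoint X Y →
                      Crossing a₁ a₂ b₁ b₂ → ∃ λ Z → ∃₂ λ c d → Arc v c d Z × length Z ≡ length X + length Y
  Arc-join-crossing {X = X} {Y} A B X#Y (inj₁ r) =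
    reverse X ++ Y , _ , _ , Arc-join (Arc-reverse A) B r (λ (m , m′) → X#Y (reverse⁻ m , m′)) ,
    trans (length-++ (reverse X)) (cong (_+ length Y) (length-reverse X))
  Arc-join-crossing {X = X} {Y} A B X#Y (inj₂ (inj₁ r)) =
    Y ++ X , _ , _ , Arc-join B A (~-sym G r) (λ (m , m′) → X#Y (m′ , m)) ,
    trans (length-++ Y) (+-comm (length Y) (length X))
  Arc-join-crossing {X = X} A B X#Y (inj₂ (inj₂ (inj₁ r))) =
    _ , _ , _ , Arc-join A B r X#Y , length-++ X
  Arc-join-crossing {X = X} {Y} A B X#Y (inj₂ (inj₂ (inj₂ r))) =
    X ++ reverse Y , _ , _ , Arc-join A (Arc-reverse B) r (λ (m , m′) → X#Y (m , reverse⁻ m′)) ,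
    trans (length-++ X) (cong (length X +_) (length-reverse Y))

  crossing-arcs-length : ∀ {c v a₁ a₂ b₁ b₂ X Y} → CyclesAtMost c → 3 ≤ c → Arc v a₁ a₂ X → Arc v b₁ b₂ Y →
                         Disjoint X Y → Crossing a₁ a₂ b₁ b₂ → length X + length Y < c
  crossing-arcs-length bound c≥3 A B X#Y crossing with Arc-join-crossing A B X#Y crossing
  ... | _ , _ , _ , C , len = subst (_< _) len (Arc-length< bound c≥3 C)

  OneOf : V G → V G → V G → Set
  OneOf a₁ a₂ x = x ≡ a₁ ⊎ x ≡ a₂

  private
    crossing-edge : ∀ {a₁ a₂ b₁ b₂ x y} → x ∼ y → OneOf a₁ a₂ x → OneOf b₁ b₂ y → Crossing a₁ a₂ b₁ b₂
    crossing-edge r (inj₁ refl) (inj₁ refl) = inj₁ r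
    crossing-edge r (inj₁ refl) (inj₂ refl) = inj₂ (inj₁ r)
    crossing-edge r (inj₂ refl) (inj₁ refl) = inj₂ (inj₂ (inj₁ r))
    crossing-edge r (inj₂ refl) (inj₂ refl) = inj₂ (inj₂ (inj₂ r))

    no-triangle-in-pair : ∀ {a₁ a₂ x y z} → x ∼ y → x ∼ z → y ∼ z →
                          OneOf a₁ a₂ x → OneOf a₁ a₂ y → OneOf a₁ a₂ z → ⊥
    no-triangle-in-pair xy xz yz (inj₁ refl) (inj₁ refl) _ = ~-irr G _ xy
    no-triangle-in-pair xy xz yz (inj₂ refl) (inj₂ refl) _ = ~-irr G _ xy
    no-triangle-in-pair xy xz yz (inj₁ refl) (inj₂ refl) (inj₁ refl) = ~-irr G _ xz
    no-triangle-in-pair xy xz yz (inj₁ refl) (inj₂ refl) (inj₂ refl) = ~-irr G _ yz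
    no-triangle-in-pair xy xz yz (inj₂ refl) (inj₁ refl) (inj₁ refl) = ~-irr G _ yz
    no-triangle-in-pair xy xz yz (inj₂ refl) (inj₁ refl) (inj₂ refl) = ~-irr G _ xz

  triangle-crossing : ∀ {a₁ a₂ b₁ b₂ x y z} → x ∼ y → x ∼ z → y ∼ z →
                      OneOf a₁ a₂ x ⊎ OneOf b₁ b₂ x → OneOf a₁ a₂ y ⊎ OneOf b₁ b₂ y →
                      OneOf a₁ a₂ z ⊎ OneOf b₁ b₂ z → Crossing a₁ a₂ b₁ b₂
  triangle-crossing xy xz yz (inj₁ x∈a) (inj₁ y∈a) (inj₁ z∈a) = ⊥-elim (no-triangle-in-pair xy xz yz x∈a y∈a z∈a)
  triangle-crossing xy xz yz (inj₂ x∈b) (inj₂ y∈b) (inj₂ z∈b) = ⊥-elim (no-triangle-in-pair xy xz yz x∈b y∈b z∈b)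
  triangle-crossing xy xz yz (inj₁ x∈a) (inj₂ y∈b) _ = crossing-edge xy x∈a y∈b
  triangle-crossing xy xz yz (inj₂ x∈b) (inj₁ y∈a) _ = crossing-edge (~-sym G xy) y∈a x∈b
  triangle-crossing xy xz yz (inj₁ x∈a) (inj₁ y∈a) (inj₂ z∈b) = crossing-edge xz x∈a z∈b
  triangle-crossing xy xz yz (inj₂ x∈b) (inj₂ y∈b) (inj₁ z∈a) = crossing-edge (~-sym G xz) z∈a x∈b

-- Routes through K₄

Unique-Fin4-length : ∀ {ts : List (Fin 4)} → Unique ts → length ts ≤ 4
Unique-Fin4-length u = Unique-length-≤ u λ {t} _ → ∈-allFin t

-- Both facts are checked by exhausting Fin 4, and kept abstract so that the
-- decision procedure is never unfolded where they are used.
abstract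
  route : ∀ (p q : Fin 4) → p ≢ q → ∃₂ λ r s → Unique (p ∷ r ∷ s ∷ q ∷ [])
  route = from-yes (all? λ p → all? λ q → ¬? (p ≟ q) →-dec
    any? λ r → any? λ s → unique? (p ∷ r ∷ s ∷ q ∷ []))

  route-covers : ∀ (p r s q : Fin 4) → Unique (p ∷ r ∷ s ∷ q ∷ []) → ∀ t → t ∈ p ∷ r ∷ s ∷ q ∷ []
  route-covers = from-yes (all? λ p → all? λ r → all? λ s → all? λ q →
    unique? (p ∷ r ∷ s ∷ q ∷ []) →-dec all? λ t → t ∈? (p ∷ r ∷ s ∷ q ∷ []))

route-swap : ∀ {p r s q : Fin 4} → Unique (p ∷ r ∷ s ∷ q ∷ []) → Unique (p ∷ s ∷ r ∷ q ∷ [])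
route-swap ((p≢r ∷ p≢s ∷ p≢q ∷ []) ∷ (r≢s ∷ r≢q ∷ []) ∷ (s≢q ∷ []) ∷ [] ∷ []) =
  (p≢s ∷ p≢r ∷ p≢q ∷ []) ∷ ((≢-sym r≢s) ∷ s≢q ∷ []) ∷ (r≢q ∷ []) ∷ [] ∷ []

route-walk : ∀ {p r s q : Fin 4} → Unique (p ∷ r ∷ s ∷ q ∷ []) → Walk _≢_ p q (p ∷ r ∷ s ∷ q ∷ [])
route-walk ((p≢r ∷ _) ∷ (r≢s ∷ _) ∷ (s≢q ∷ []) ∷ [] ∷ []) = step p≢r (step r≢s (step s≢q (stop _)))

other : Fin 4 → Fin 4
other zero = suc zero
other (suc _) = zero

≢-other : ∀ p → p ≢ other p
≢-other zero ()
≢-other (suc _) ()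

module BlowUp (G : Graph) (v : V G) (e : NbhdEnum G v 4) where

  private
    _∼_ = _~_ G

  G′ : Graph
  G′ = blowUp G v e

  private
    _∼′_ = _~_ G′

  Old : Set
  Old = Rest G v

  ι₁ : Old → V G′
  ι₁ = inj₁

  ι₂ : Fin 4 → V G′
  ι₂ = inj₂

  pt-injective : ∀ {a b : Old} → pt a ≡ pt b → a ≡ b
  pt-injective {rest x _} {rest .x _} refl = refl

  pt≢v : (a : Old) → pt a ≢ v
  pt≢v (rest x x≢v) x≡v = ⊥-elim-irr (x≢v x≡v)

  nb-adj : ∀ {i u} → nb e i ≡ u → v ∼ u
  nb-adj {i} refl = Equivalence.from (nb-nbh e (nb e i)) (i , refl)

  adj-nb : ∀ {u} → v ∼ u → ∃ λ i → nb e i ≡ u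
  adj-nb {u} = Equivalence.to (nb-nbh e u)

  nb-distinct : ∀ {i j u w} → nb e i ≡ u → nb e j ≡ w → u ≢ w → i ≢ j
  nb-distinct refl refl u≢w refl = u≢w refl

  inj₂∉map-ι₁ : ∀ {t} (S : List Old) → inj₂ t ∉ map ι₁ S
  inj₂∉map-ι₁ S m with ∈-map⁻ ι₁ m
  ... | _ , _ , ()

  new#old : ∀ (K : List (Fin 4)) (S : List Old) → Disjoint (map ι₂ K) (map ι₁ S)
  new#old K S (m , m′) with ∈-map⁻ ι₂ m
  ... | _ , _ , refl = inj₂∉map-ι₁ S m′

  avoids⇒All≢ : ∀ {xs} → v ∉ xs → All (_≢ v) xs
  avoids⇒All≢ v∉xs = All.map (λ v≢x x≡v → v≢x (sym x≡v)) (¬Any⇒All¬ _ v∉xs)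

  lift : (xs : List (V G)) → All (_≢ v) xs → List Old
  lift [] [] = []
  lift (x ∷ xs) (x≢v ∷ ps) = rest x x≢v ∷ lift xs ps

  map-pt-lift : ∀ xs ps → map pt (lift xs ps) ≡ xs
  map-pt-lift [] [] = refl
  map-pt-lift (x ∷ xs) (_ ∷ ps) = cong (x ∷_) (map-pt-lift xs ps)

  length-lift : ∀ xs ps → length (map ι₁ (lift xs ps)) ≡ length xs
  length-lift [] [] = refl
  length-lift (x ∷ xs) (_ ∷ ps) = cong suc (length-lift xs ps)

  Unique-lift : ∀ {xs} ps → Unique xs → Unique (map ι₁ (lift xs ps))
  Unique-lift {xs} ps u = Unique.map⁺ (λ { refl → refl })
    (Unique.map⁻ (subst Unique (sym (map-pt-lift xs ps)) u))

  ∈-lift⁺ : ∀ {z xs} ps → z ∈ xs → (z≢v : z ≢ v) → inj₁ (rest z z≢v) ∈ map ι₁ (lift xs ps)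
  ∈-lift⁺ (_ ∷ _) (here refl) _ = here refl
  ∈-lift⁺ (_ ∷ ps) (there m) z≢v = there (∈-lift⁺ ps m z≢v)

  ∈-lift⁻ : ∀ {a} xs ps → inj₁ a ∈ map ι₁ (lift xs ps) → pt a ∈ xs
  ∈-lift⁻ (_ ∷ _) (_ ∷ _) (here refl) = here refl
  ∈-lift⁻ (_ ∷ xs) (_ ∷ ps) (there m) = there (∈-lift⁻ xs ps m)

  walk-lift : ∀ {a b xs} .(a≢v : a ≢ v) .(b≢v : b ≢ v) → Walk _∼_ a b xs → (ps : All (_≢ v) xs) →
              Walk _∼′_ (inj₁ (rest a a≢v)) (inj₁ (rest b b≢v)) (map ι₁ (lift xs ps))
  walk-lift _ _ (stop a) (_ ∷ []) = stop _
  walk-lift _ b≢v (step r w@(stop _)) (_ ∷ ps@(b≢v′ ∷ _)) = step r (walk-lift b≢v′ b≢v w ps)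
  walk-lift _ b≢v (step r w@(step _ _)) (_ ∷ ps@(b≢v′ ∷ _)) = step r (walk-lift b≢v′ b≢v w ps)

  walk-inj₁⁻ : ∀ {s S y} → Walk _∼′_ (inj₁ s) y (map ι₁ (s ∷ S)) →
               ∃ λ t → y ≡ inj₁ t × t ∈ s ∷ S × Walk _∼_ (pt s) (pt t) (map pt (s ∷ S))
  walk-inj₁⁻ {s} {[]} (stop _) = s , refl , here refl , stop _
  walk-inj₁⁻ {S = s′ ∷ S} w₀ with walk-uncons w₀
  ... | r , w with walk-inj₁⁻ w
  ... | t , refl , t∈ , w′ = t , refl , there t∈ , step r w′

  walk-inj₂⁻ : ∀ {r R y} → Walk _∼′_ (inj₂ r) y (map ι₂ (r ∷ R)) → ∃ λ q → y ≡ inj₂ q × q ∈ r ∷ R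
  walk-inj₂⁻ {r} {[]} (stop _) = r , refl , here refl
  walk-inj₂⁻ {R = r′ ∷ R} w₀ with walk-inj₂⁻ (proj₂ (walk-uncons w₀))
  ... | q , refl , q∈ = q , refl , there q∈

  Unique-map-pt : ∀ {S : List Old} → Unique (map ι₁ S) → Unique (map pt S)
  Unique-map-pt u = Unique.map⁺ pt-injective (Unique.map⁻ u)

  pt∈⇒ι₁∈ : ∀ {a} (S : List Old) → pt a ∈ map pt S → inj₁ a ∈ map ι₁ S
  pt∈⇒ι₁∈ {a} S m with ∈-map⁻ (pt {G} {v}) m
  ... | b , b∈S , pt≡pt with pt-injective {a} {b} pt≡pt
  ... | refl = ∈-map⁺ ι₁ b∈S

  Disjoint-map-pt : ∀ {S S′ : List Old} → Disjoint (map ι₁ S) (map ι₁ S′) → Disjoint (map pt S) (map pt S′)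
  Disjoint-map-pt {S} {S′} S#S′ (m , m′) with ∈-map⁻ (pt {G} {v}) m
  ... | a , _ , refl = S#S′ (pt∈⇒ι₁∈ {a} S m , pt∈⇒ι₁∈ {a} S′ m′)

  v∉map-pt : (S : List Old) → v ∉ map pt S
  v∉map-pt S m with ∈-map⁻ (pt {G} {v}) m
  ... | a , _ , v≡pt = pt≢v a (sym v≡pt)

  -- Hamilton paths

  Exits : Fin 4 → List (V G) → Set
  Exits q [] = ⊤
  Exits q (b ∷ _) = nb e q ≡ b

  exit-index : ∀ p {B} → Linked _∼_ (v ∷ B) → nb e p ∉ B → ∃ λ q → p ≢ q × Exits q B
  exit-index p {[]} _ _ = other p , ≢-other p , tt
  exit-index p {b ∷ B} (r ∷ _) nbp∉B with adj-nb r
  ... | q , nbq≡b = q , (λ { refl → nbp∉B (here nbq≡b) }) , nbq≡b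

  route-then-lift : ∀ {p r s q} B (ps : All (_≢ v) B) → Unique (p ∷ r ∷ s ∷ q ∷ []) → Exits q B →
                    Linked _∼_ B → ∃ λ y → Walk _∼′_ (inj₂ p) y (map ι₂ (p ∷ r ∷ s ∷ q ∷ []) ++ map ι₁ (lift B ps))
  route-then-lift [] [] u₄ _ _ = _ , walk-map ι₂ (λ p≢q → p≢q) (route-walk u₄)
  route-then-lift (b ∷ B) ps@(b≢v ∷ _) u₄ nbq≡b l with Linked⇒Walk l
  ... | _ , w = _ , walk-++ (walk-map ι₂ (λ p≢q → p≢q) (route-walk u₄)) nbq≡b
                    (walk-lift b≢v (All.lookup ps (walk-last∈ w)) w ps)

  splice : ∀ A B → All (_≢ v) A → All (_≢ v) B → Fin 4 → Fin 4 → Fin 4 → Fin 4 → List (V G′)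
  splice A B psA psB p r s q = map ι₁ (lift A psA) ++ map ι₂ (p ∷ r ∷ s ∷ q ∷ []) ++ map ι₁ (lift B psB)

  splice-unique : ∀ {A B} psA psB {p r s q} → Unique (A ++ v ∷ B) → Unique (p ∷ r ∷ s ∷ q ∷ []) →
                  Unique (splice A B psA psB p r s q)
  splice-unique {A} {B} psA psB u u₄ with Unique-++⁻ A u
  ... | uA , _ ∷ uB , A#vB =
    Unique.++⁺ (Unique-lift psA uA)
      (Unique.++⁺ (Unique.map⁺ (λ { refl → refl }) u₄) (Unique-lift psB uB) (new#old _ _))
      λ { (m , m′) → disjoint m (∈-++⁻ (map ι₂ _) m′) }
    where
    disjoint : ∀ {z} → z ∈ map ι₁ (lift A psA) → z ∈ map ι₂ _ ⊎ z ∈ map ι₁ (lift B psB) → ⊥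
    disjoint m (inj₁ m′) = new#old _ _ (m′ , m)
    disjoint m (inj₂ m′) with ∈-map⁻ ι₁ m
    ... | _ , _ , refl = A#vB (∈-lift⁻ A psA m , there (∈-lift⁻ B psB m′))

  splice-covers : ∀ {A B} psA psB {p r s q} → (∀ x → x ∈ A ++ v ∷ B) → Unique (p ∷ r ∷ s ∷ q ∷ []) →
                  ∀ z → z ∈ splice A B psA psB p r s q
  splice-covers psA psB covers u₄ (inj₂ t) =
    ∈-++⁺ʳ (map ι₁ (lift _ psA)) (∈-++⁺ˡ (∈-map⁺ ι₂ (route-covers _ _ _ _ u₄ t)))
  splice-covers {A} psA psB covers u₄ (inj₁ c) with ∈-++⁻ A (covers (pt c))
  ... | inj₁ m = ∈-++⁺ˡ (∈-lift⁺ psA m (pt≢v c))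
  ... | inj₂ (here pt≡v) = ⊥-elim (pt≢v c pt≡v)
  ... | inj₂ (there m) = ∈-++⁺ʳ (map ι₁ (lift A psA)) (∈-++⁺ʳ (map ι₂ _) (∈-lift⁺ psB m (pt≢v c)))

  second-index : ∀ {w} → HamPathFrom G v w → ∃ λ j → nb e j ≡ w
  second-index (_ , _ , r ∷ _ , _) = adj-nb r

  hamPaths-from-new : ∀ i {j} → i ≢ j → HamPathFrom G v (nb e j) →
                 ∃₂ λ w₁ w₂ → w₁ ≢ w₂ × HamPathFrom G′ (inj₂ i) w₁ × HamPathFrom G′ (inj₂ i) w₂
  hamPaths-from-new i {j} i≢j (B , u , _ ∷ l , covers) with route i j i≢j
  ... | r , s , u₄@(_ ∷ (r≢s ∷ _) ∷ _) = inj₂ r , inj₂ s , (λ { refl → r≢s refl }) , via u₄ , via (route-swap u₄)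
    where
    ps : All (_≢ v) (nb e j ∷ B)
    ps = avoids⇒All≢ (Unique.Unique[x∷xs]⇒x∉xs u)
    via : ∀ {r s} → Unique (i ∷ r ∷ s ∷ j ∷ []) → HamPathFrom G′ (inj₂ i) (inj₂ r)
    via u₄ = _ , splice-unique [] ps u u₄ , Walk⇒Linked (proj₂ (route-then-lift _ ps u₄ refl l)) ,
             splice-covers [] ps covers u₄

  splice-from-old : ∀ (a : Old) A′ B → HamList G (pt a ∷ A′ ++ v ∷ B) →
                    ∃ λ (ψ : All (_≢ v) A′) → ∃₂ λ p T → HamList G′ (inj₁ a ∷ map ι₁ (lift A′ ψ) ++ inj₂ p ∷ T)
  splice-from-old a A′ B (u , l , covers) with Unique-++⁻ (pt a ∷ A′) u | Linked⇒Walk l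
  ... | _ , uvB , A#vB | _ , W with walk-split (pt a) A′ v B W
  ... | _ , WA , b∼v , WvB with adj-nb (~-sym G b∼v)
  ... | p , nbp≡b with exit-index p (Walk⇒Linked WvB) (λ m → A#vB (walk-last∈ WA , there (subst (_∈ B) nbp≡b m)))
  ... | q , p≢q , exits with route p q p≢q
  ... | r , s , u₄ =
    ψ , p , _ , splice-unique psA psB u u₄ , Walk⇒Linked (proj₂ spliced) , splice-covers psA psB covers u₄
    where
    psA : All (_≢ v) (pt a ∷ A′)
    psA = avoids⇒All≢ (λ m → A#vB (m , here refl))
    ψ : All (_≢ v) A′
    ψ = All.tail psA
    psB : All (_≢ v) B
    psB = avoids⇒All≢ (Unique.Unique[x∷xs]⇒x∉xs uvB)
    spliced : ∃ λ y → Walk _∼′_ (inj₁ a) y (splice (pt a ∷ A′) B psA psB p r s q)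
    spliced = _ , walk-++ (walk-lift (pt≢v a) (All.lookup psA (walk-last∈ WA)) WA psA) nbp≡b
                    (proj₂ (route-then-lift B psB u₄ exits (Linked.tail (Walk⇒Linked WvB))))

  -- How the second vertex of a Hamilton path of G reappears after splicing.
  Represents : V G → V G′ → Set
  Represents w w′ = (w ≡ v × ∃ λ t → w′ ≡ inj₂ t) ⊎ (∃ λ (w≢v : w ≢ v) → w′ ≡ inj₁ (rest w w≢v))

  Represents-≢ : ∀ {w₁ w₂ w₁′ w₂′} → Represents w₁ w₁′ → Represents w₂ w₂′ → w₁ ≢ w₂ → w₁′ ≢ w₂′
  Represents-≢ (inj₁ (w₁≡v , _ , refl)) (inj₁ (w₂≡v , _ , refl)) w₁≢w₂ _ = w₁≢w₂ (trans w₁≡v (sym w₂≡v))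
  Represents-≢ (inj₁ (_ , _ , refl)) (inj₂ (_ , refl)) _ ()
  Represents-≢ (inj₂ (_ , refl)) (inj₁ (_ , _ , refl)) _ ()
  Represents-≢ (inj₂ (_ , refl)) (inj₂ (_ , refl)) w₁≢w₂ refl = w₁≢w₂ refl

  hamPath-from-old : ∀ (a : Old) {w} → HamPathFrom G (pt a) w →
                ∃ λ w′ → HamPathFrom G′ (inj₁ a) w′ × Represents w w′
  hamPath-from-old a {w} (rest₀ , h) with ∈-∃++ (proj₂ (proj₂ h) v)
  ... | [] , B , eq = ⊥-elim (pt≢v a (∷-injectiveˡ eq))
  ... | _ ∷ A′ , B , eq with ∷-injective eq
  ... | refl , w∷rest≡ = second A′ w∷rest≡ (splice-from-old a A′ B (subst (HamList G) eq h))
    where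
    second : ∀ A′ → w ∷ rest₀ ≡ A′ ++ v ∷ B →
             (∃ λ (ψ : All (_≢ v) A′) → ∃₂ λ p T → HamList G′ (inj₁ a ∷ map ι₁ (lift A′ ψ) ++ inj₂ p ∷ T)) →
             ∃ λ w′ → HamPathFrom G′ (inj₁ a) w′ × Represents w w′
    second [] eq ([] , p , _ , h′) = inj₂ p , (_ , h′) , inj₁ (∷-injectiveˡ eq , p , refl)
    second (_ ∷ _) eq (a′≢v ∷ _ , _ , _ , h′) with ∷-injectiveˡ eq
    ... | refl = _ , (_ , h′) , inj₂ (a′≢v , refl)

  DHT-blowUp : DHT G → DHT G′
  DHT-blowUp dht (inj₂ i) with dht v
  ... | w₁ , w₂ , w₁≢w₂ , P₁ , P₂ with second-index P₁ | second-index P₂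
  ... | j₁ , refl | j₂ , refl with i ≟ j₁
  ...   | yes refl = hamPaths-from-new i (λ { refl → w₁≢w₂ refl }) P₂
  ...   | no i≢j₁ = hamPaths-from-new i i≢j₁ P₁
  DHT-blowUp dht (inj₁ a) with dht (pt a)
  ... | _ , _ , w₁≢w₂ , P₁ , P₂ with hamPath-from-old a P₁ | hamPath-from-old a P₂
  ... | w₁′ , P₁′ , R₁ | w₂′ , P₂′ , R₂ = w₁′ , w₂′ , Represents-≢ R₁ R₂ w₁≢w₂ , P₁′ , P₂′

  -- Cycles

  cycle-through-v : ∀ {Y} → IsCycle G (v ∷ Y) →
                    ∃₂ λ p zs → IsCycle G′ zs × length zs ≡ 3 + length (v ∷ Y) × inj₂ p ∈ zs
  cycle-through-v {[]} (s≤s () , _)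
  cycle-through-v {_ ∷ []} (s≤s (s≤s ()) , _)
  cycle-through-v {Y@(y ∷ _ ∷ _)} (_ , u@(_ ∷ u′) , l) with Linked-∷ʳ⇒Walk Y l
  ... | b , W , b∼v with walk-uncons W
  ... | v∼y , WY with adj-nb v∼y | adj-nb (~-sym G b∼v)
  ... | q , nbq≡y | p , nbp≡b
    with route p q (nb-distinct nbp≡b nbq≡y
                      λ { refl → Unique.Unique[x∷xs]⇒x∉xs u′ (walk-last∈ (proj₂ (walk-uncons WY))) })
  ... | r , s , u₄ = p , _ , (s≤s (s≤s (s≤s z≤n)) , splice-unique [] ps u u₄ , walk-close G′ W′ nbp≡b) ,
                     cong (λ k → 4 + k) (length-lift Y ps) , here refl
    where
    ps : All (_≢ v) Y
    ps = avoids⇒All≢ (Unique.Unique[x∷xs]⇒x∉xs u)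
    b≢v : b ≢ v
    b≢v = All.lookup ps (walk-last∈ WY)
    W′ : Walk _∼′_ (inj₂ p) (inj₁ (rest b b≢v)) (splice [] Y [] ps p r s q)
    W′ = walk-++ (walk-map ι₂ (λ p≢q → p≢q) (route-walk u₄)) nbq≡y (walk-lift (All.lookup ps (here refl)) b≢v WY ps)

  clique-crossing : InClique4 G v → ∀ {p q r s} → Unique (p ∷ q ∷ r ∷ s ∷ []) →
                    Crossing G (nb e q) (nb e r) (nb e s) (nb e p)
  clique-crossing (f , f-adj , i₀ , fi₀≡v) {p} {q} {r} {s} u₄
    with route (other i₀) i₀ (λ eq → ≢-other i₀ (sym eq))
  ... | j₂ , j₃ , (j₁≢j₂ ∷ j₁≢j₃ ∷ j₁≢i₀ ∷ []) ∷ (j₂≢j₃ ∷ j₂≢i₀ ∷ []) ∷ (j₃≢i₀ ∷ []) ∷ [] ∷ [] =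
    triangle-crossing G (f-adj _ _ j₁≢j₂) (f-adj _ _ j₁≢j₃) (f-adj _ _ j₂≢j₃)
      (side (≢-sym j₁≢i₀)) (side (≢-sym j₂≢i₀)) (side (≢-sym j₃≢i₀))
    where
    side : ∀ {j} → i₀ ≢ j → OneOf G (nb e q) (nb e r) (f j) ⊎ OneOf G (nb e s) (nb e p) (f j)
    side {j} i₀≢j with adj-nb (subst (_∼ f j) fi₀≡v (f-adj i₀ j i₀≢j))
    ... | t , nbt≡fj with route-covers p q r s u₄ t
    ... | here refl = inj₂ (inj₂ (sym nbt≡fj))
    ... | there (here refl) = inj₁ (inj₁ (sym nbt≡fj))
    ... | there (there (here refl)) = inj₁ (inj₂ (sym nbt≡fj))
    ... | there (there (there (here refl))) = inj₂ (inj₁ (sym nbt≡fj))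

  excursion : ∀ {r R s S y j} → Walk _∼′_ (inj₂ r) y (map ι₂ (r ∷ R) ++ map ι₁ (s ∷ S)) → y ∼′ inj₂ j →
              Unique (map ι₁ (s ∷ S)) → ∃ λ q → q ∈ r ∷ R × Arc G v (nb e q) (nb e j) (map pt (s ∷ S))
  excursion {r} {R} {s} {S} W y∼j uS with walk-split (inj₂ r) (map ι₂ R) (inj₁ s) (map ι₁ S) W
  ... | _ , WR , q∼s , WS with walk-inj₂⁻ WR | walk-inj₁⁻ WS
  ... | q , refl , q∈ | t , refl , _ , GW = q , q∈ , record
    { walk = subst₂ (λ a b → Walk _∼_ a b _) (sym q∼s) (sym y∼j) GW
    ; start-adj = nb-adj refl ; end-adj = nb-adj refl ; unique = Unique-map-pt uS ; avoids = v∉map-pt (s ∷ S) }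

  excursion-then : ∀ {r R s S r′ X y} →
                   Walk _∼′_ (inj₂ r) y (map ι₂ (r ∷ R) ++ map ι₁ (s ∷ S) ++ inj₂ r′ ∷ X) → Unique (map ι₁ (s ∷ S)) →
                   (∃ λ q → q ∈ r ∷ R × Arc G v (nb e q) (nb e r′) (map pt (s ∷ S)))
                   × Walk _∼′_ (inj₂ r′) y (inj₂ r′ ∷ X)
  excursion-then {r} {R} {s} {S} {r′} {X} W uS
    with walk-split-++ (inj₂ r) (map ι₂ R) (map ι₁ (s ∷ S)) (inj₂ r′) X W
  ... | _ , W₁ , entry , W₂ = excursion W₁ entry uS , W₂

  news⊆ : ∀ K → map ι₂ K ⊆ map ι₂ (allFin 4)
  news⊆ K m with ∈-map⁻ ι₂ m
  ... | t , _ , refl = ∈-map⁺ ι₂ (∈-allFin t)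

  old-cycle-length : ∀ {c} → CyclesAtMost G c → ∀ S → IsCycle G′ (map ι₁ S) → length (map ι₁ S) ≤ c
  old-cycle-length {c} bound (s ∷ S) (len , u , l) with Linked-∷ʳ⇒Walk (map ι₁ S) l
  ... | _ , W , closing with walk-inj₁⁻ W
  ... | t , refl , _ , GW =
    subst (_≤ c) same-length (bound _ (subst (3 ≤_) (sym same-length) len , Unique-map-pt u , walk-close G GW closing))
    where
    same-length : length (map pt (s ∷ S)) ≡ length (map ι₁ (s ∷ S))
    same-length = trans (length-map pt (s ∷ S)) (sym (length-map ι₁ (s ∷ S)))

  data SpanOld : List (V G′) → Set where
    all-old  : ∀ S → SpanOld (map ι₁ S)
    then-new : ∀ S i T → SpanOld (map ι₁ S ++ inj₂ i ∷ T)

  spanOld : ∀ zs → SpanOld zs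
  spanOld [] = all-old []
  spanOld (inj₂ i ∷ T) = then-new [] i T
  spanOld (inj₁ s ∷ zs) with spanOld zs
  ... | all-old S = all-old (s ∷ S)
  ... | then-new S i T = then-new (s ∷ S) i T

  data SpanNew : List (V G′) → Set where
    all-new  : ∀ R → SpanNew (map ι₂ R)
    then-old : ∀ R s T → SpanNew (map ι₂ R ++ inj₁ s ∷ T)

  spanNew : ∀ zs → SpanNew zs
  spanNew [] = all-new []
  spanNew (inj₁ s ∷ T) = then-old [] s T
  spanNew (inj₂ i ∷ zs) with spanNew zs
  ... | all-new R = all-new (i ∷ R)
  ... | then-old R s T = then-old (i ∷ R) s T

  IsOld : V G′ → Set
  IsOld (inj₁ _) = ⊤
  IsOld (inj₂ _) = ⊥

  LastOld : List (V G′) → Set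
  LastOld [] = ⊥
  LastOld (x ∷ []) = IsOld x
  LastOld (_ ∷ y ∷ ys) = LastOld (y ∷ ys)

  LastOld-++⁻ : ∀ xs {y ys} → LastOld (xs ++ y ∷ ys) → LastOld (y ∷ ys)
  LastOld-++⁻ [] last = last
  LastOld-++⁻ (_ ∷ []) last = last
  LastOld-++⁻ (_ ∷ x ∷ xs) last = LastOld-++⁻ (x ∷ xs) last

  LastOld-++⁺ : ∀ xs {y ys} → LastOld (y ∷ ys) → LastOld (xs ++ y ∷ ys)
  LastOld-++⁺ [] last = last
  LastOld-++⁺ (_ ∷ []) last = last
  LastOld-++⁺ (_ ∷ x ∷ xs) last = LastOld-++⁺ (x ∷ xs) last

  LastOld-olds : ∀ s S → LastOld (map ι₁ (s ∷ S))
  LastOld-olds s [] = tt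
  LastOld-olds s (s′ ∷ S) = LastOld-olds s′ S

  ¬LastOld-news : ∀ r R → ¬ LastOld (map ι₂ (r ∷ R))
  ¬LastOld-news r [] ()
  ¬LastOld-news r (r′ ∷ R) = ¬LastOld-news r′ R

  -- A cycle list from a new to an old vertex, cut into maximal runs of new and old
  -- vertices; three-runs covers all cycles with three or more runs of new vertices.
  data Alternating : List (V G′) → Set where
    one-run    : ∀ r R s S → Alternating (map ι₂ (r ∷ R) ++ map ι₁ (s ∷ S))
    two-runs   : ∀ r₁ R₁ s₁ S₁ r₂ R₂ s₂ S₂ →
                 Alternating (map ι₂ (r₁ ∷ R₁) ++ map ι₁ (s₁ ∷ S₁) ++ map ι₂ (r₂ ∷ R₂) ++ map ι₁ (s₂ ∷ S₂))
    three-runs : ∀ r₁ R₁ s₁ S₁ r₂ R₂ s₂ S₂ r₃ R₃ s₃ T →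
                 Alternating (map ι₂ (r₁ ∷ R₁) ++ map ι₁ (s₁ ∷ S₁) ++ map ι₂ (r₂ ∷ R₂) ++ map ι₁ (s₂ ∷ S₂) ++
                              map ι₂ (r₃ ∷ R₃) ++ inj₁ s₃ ∷ T)

  alternating : ∀ r zs → LastOld (inj₂ r ∷ zs) → Alternating (inj₂ r ∷ zs)
  alternating r₁ zs last with spanNew zs
  ... | all-new R₁ = ⊥-elim (¬LastOld-news r₁ R₁ last)
  ... | then-old R₁ s₁ zs₁ with spanOld zs₁
  ...   | all-old S₁ = one-run r₁ R₁ s₁ S₁
  ...   | then-new S₁ r₂ zs₂ with spanNew zs₂
  ...     | all-new R₂ = ⊥-elim (¬LastOld-news r₂ R₂ last₂)
    where last₂ = LastOld-++⁻ (map ι₁ (s₁ ∷ S₁)) (LastOld-++⁻ (map ι₂ (r₁ ∷ R₁)) last)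
  ...     | then-old R₂ s₂ zs₃ with spanOld zs₃
  ...       | all-old S₂ = two-runs r₁ R₁ s₁ S₁ r₂ R₂ s₂ S₂
  ...       | then-new S₂ r₃ zs₄ with spanNew zs₄
  ...         | then-old R₃ s₃ T = three-runs r₁ R₁ s₁ S₁ r₂ R₂ s₂ S₂ r₃ R₃ s₃ T
  ...         | all-new R₃ = ⊥-elim (¬LastOld-news r₃ R₃ last₃)
    where last₃ = LastOld-++⁻ (map ι₁ (s₂ ∷ S₂)) (LastOld-++⁻ (map ι₂ (r₂ ∷ R₂))
                    (LastOld-++⁻ (map ι₁ (s₁ ∷ S₁)) (LastOld-++⁻ (map ι₂ (r₁ ∷ R₁)) last)))

  new-apart : ∀ {xs ys : List (V G′)} {i j} → Disjoint xs ys → inj₂ i ∈ xs → inj₂ j ∈ ys → i ≢ j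
  new-apart xs#ys m m′ i≡j = Disjoint⇒≢ xs#ys m m′ (cong ι₂ i≡j)

  nb-apart : ∀ {S S′ : List Old} {i j} → Disjoint (map ι₁ S) (map ι₁ S′) →
             nb e i ∈ map pt S → nb e j ∈ map pt S′ → i ≢ j
  nb-apart S#S′ m m′ i≡j = Disjoint⇒≢ (Disjoint-map-pt S#S′) m m′ (cong (nb e) i≡j)

  module CycleBound {c} (bound : CyclesAtMost G c) (c≥3 : 3 ≤ c) (clique : InClique4 G v) where

    arc-length : ∀ {a b S} → Arc G v a b (map pt S) → length (map ι₁ S) < c
    arc-length {S = S} A =
      subst (_< c) (trans (length-map pt S) (sym (length-map ι₁ S))) (Arc-length< G bound c≥3 A)

    one-run-length : ∀ r R s S → let P = map ι₂ (r ∷ R) ; Q = map ι₁ (s ∷ S) in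
                     IsCycle G′ (P ++ Q) → length (P ++ Q) ≤ c + 3
    one-run-length r R s S (_ , u , l) with Linked-∷ʳ⇒Walk _ l | Unique-++⁻ (map ι₂ (r ∷ R)) u
    ... | _ , W , closing | uP , uQ , _ with excursion W closing uQ
    ... | _ , _ , A = subst (_≤ c + 3) (sym (length-++ (map ι₂ (r ∷ R))))
                        (≤4+<⇒≤+3 (Unique-length-≤ uP (news⊆ (r ∷ R))) (arc-length {S = s ∷ S} A))

    -- The four ends of the two old runs are the four neighbours of v, so the clique at v
    -- supplies an edge between the runs.
    two-runs-length : ∀ r₁ R₁ s₁ S₁ r₂ R₂ s₂ S₂ →
      let P₁ = map ι₂ (r₁ ∷ R₁) ; Q₁ = map ι₁ (s₁ ∷ S₁) ; P₂ = map ι₂ (r₂ ∷ R₂) ; Q₂ = map ι₁ (s₂ ∷ S₂) in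
      IsCycle G′ (P₁ ++ Q₁ ++ P₂ ++ Q₂) → length (P₁ ++ Q₁ ++ P₂ ++ Q₂) ≤ c + 3
    two-runs-length r₁ R₁ s₁ S₁ r₂ R₂ s₂ S₂ (_ , u , l)
      with Unique-++⁻ (map ι₂ (r₁ ∷ R₁)) u
    ... | uP₁ , u₁ , P₁#rest with Unique-++⁻ (map ι₁ (s₁ ∷ S₁)) u₁
    ... | uQ₁ , u₂ , Q₁#rest with Unique-++⁻ (map ι₂ (r₂ ∷ R₂)) u₂
    ... | uP₂ , uQ₂ , _ with Linked-∷ʳ⇒Walk _ l
    ... | _ , W , closing with excursion-then W uQ₁
    ... | (q₁ , q₁∈ , A₁) , W₂ with excursion W₂ closing uQ₂
    ... | q₂ , q₂∈ , A₂ = begin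
      length (P₁ ++ Q₁ ++ P₂ ++ Q₂)
        ≡⟨ length-split ⟩
      length P₁ + (length Q₁ + (length P₂ + length Q₂))
        ≡⟨ +-interchange (length P₁) (length Q₁) (length P₂) (length Q₂) ⟩
      (length P₁ + length P₂) + (length Q₁ + length Q₂)
        ≤⟨ ≤4+<⇒≤+3 inner-bound outer-bound ⟩
      c + 3
        ∎
      where
      open ≤-Reasoning
      P₁ Q₁ P₂ Q₂ : List (V G′)
      P₁ = map ι₂ (r₁ ∷ R₁)
      Q₁ = map ι₁ (s₁ ∷ S₁)
      P₂ = map ι₂ (r₂ ∷ R₂)
      Q₂ = map ι₁ (s₂ ∷ S₂)
      P₁#P₂ : Disjoint P₁ P₂
      P₁#P₂ (m , m′) = P₁#rest (m , ∈-++⁺ʳ Q₁ (∈-++⁺ˡ m′))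
      Q₁#Q₂ : Disjoint Q₁ Q₂
      Q₁#Q₂ (m , m′) = Q₁#rest (m , ∈-++⁺ʳ P₂ m′)
      apart : ∀ {i j} → i ∈ r₁ ∷ R₁ → j ∈ r₂ ∷ R₂ → i ≢ j
      apart i∈ j∈ = new-apart P₁#P₂ (∈-map⁺ ι₂ i∈) (∈-map⁺ ι₂ j∈)
      distinct : Unique (r₁ ∷ q₁ ∷ r₂ ∷ q₂ ∷ [])
      distinct = ((λ r₁≡q₁ → nb-apart Q₁#Q₂ (Arc-start∈ G A₁) (Arc-end∈ G A₂) (sym r₁≡q₁))
                    ∷ apart (here refl) (here refl) ∷ apart (here refl) q₂∈ ∷ [])
               ∷ (apart q₁∈ (here refl) ∷ apart q₁∈ q₂∈ ∷ [])
               ∷ (nb-apart Q₁#Q₂ (Arc-end∈ G A₁) (Arc-start∈ G A₂) ∷ [])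
               ∷ [] ∷ []
      inner-bound : length P₁ + length P₂ ≤ 4
      inner-bound = subst (_≤ 4) (length-++ P₁) (Unique-length-≤ (Unique.++⁺ uP₁ uP₂ P₁#P₂)
                      λ m → [ news⊆ (r₁ ∷ R₁) , news⊆ (r₂ ∷ R₂) ]′ (∈-++⁻ P₁ m))
      length-map′ : ∀ S → length (map pt S) ≡ length (map ι₁ S)
      length-map′ S = trans (length-map pt S) (sym (length-map ι₁ S))
      outer-bound : length Q₁ + length Q₂ < c
      outer-bound = subst (_< c) (cong₂ _+_ (length-map′ (s₁ ∷ S₁)) (length-map′ (s₂ ∷ S₂)))
        (crossing-arcs-length G bound c≥3 A₁ A₂ (Disjoint-map-pt Q₁#Q₂) (clique-crossing clique distinct))
      length-split : length (P₁ ++ Q₁ ++ P₂ ++ Q₂) ≡ length P₁ + (length Q₁ + (length P₂ + length Q₂))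
      length-split = trans (length-++ P₁) (cong (length P₁ +_)
                       (trans (length-++ Q₁) (cong (length Q₁ +_) (length-++ P₂))))

    three-runs-impossible : ∀ r₁ R₁ s₁ S₁ r₂ R₂ s₂ S₂ r₃ R₃ s₃ T →
      let P₁ = map ι₂ (r₁ ∷ R₁) ; Q₁ = map ι₁ (s₁ ∷ S₁) ; P₂ = map ι₂ (r₂ ∷ R₂) ; Q₂ = map ι₁ (s₂ ∷ S₂)
          P₃ = map ι₂ (r₃ ∷ R₃) in
      ¬ IsCycle G′ (P₁ ++ Q₁ ++ P₂ ++ Q₂ ++ P₃ ++ inj₁ s₃ ∷ T)
    three-runs-impossible r₁ R₁ s₁ S₁ r₂ R₂ s₂ S₂ r₃ R₃ s₃ T (_ , u , l)
      with Unique-++⁻ (map ι₂ (r₁ ∷ R₁)) u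
    ... | _ , u₁ , P₁#rest with Unique-++⁻ (map ι₁ (s₁ ∷ S₁)) u₁
    ... | uQ₁ , u₂ , Q₁#rest with Unique-++⁻ (map ι₂ (r₂ ∷ R₂)) u₂
    ... | _ , u₃ , P₂#rest with Unique-++⁻ (map ι₁ (s₂ ∷ S₂)) u₃
    ... | uQ₂ , _ , Q₂#rest with Linked-∷ʳ⇒Walk _ l
    ... | _ , W , _ with excursion-then W uQ₁
    ... | (q₁ , q₁∈ , A₁) , W₂ with excursion-then W₂ uQ₂
    ... | (q₂ , q₂∈ , A₂) , W₃ with walk-split (inj₂ r₃) (map ι₂ R₃) (inj₁ s₃) T W₃
    ... | _ , W₃′ , exit₃ , _ with walk-inj₂⁻ W₃′
    ... | q₃ , refl , q₃∈ = 5≰4 (Unique-Fin4-length distinct)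
      where
      5≰4 : ¬ 5 ≤ 4
      5≰4 (s≤s (s≤s (s≤s (s≤s ()))))
      Q₁ P₂ Q₂ P₃ : List (V G′)
      Q₁ = map ι₁ (s₁ ∷ S₁)
      P₂ = map ι₂ (r₂ ∷ R₂)
      Q₂ = map ι₁ (s₂ ∷ S₂)
      P₃ = map ι₂ (r₃ ∷ R₃)
      in₂ : ∀ {i} → i ∈ r₂ ∷ R₂ → inj₂ i ∈ P₂
      in₂ = ∈-map⁺ ι₂
      in₃ : ∀ {i} → i ∈ r₃ ∷ R₃ → inj₂ i ∈ P₃
      in₃ = ∈-map⁺ ι₂
      apart₁₂ : ∀ {j} → j ∈ r₂ ∷ R₂ → q₁ ≢ j
      apart₁₂ j∈ = new-apart P₁#rest (∈-map⁺ ι₂ q₁∈) (∈-++⁺ʳ Q₁ (∈-++⁺ˡ (in₂ j∈)))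
      apart₁₃ : ∀ {j} → j ∈ r₃ ∷ R₃ → q₁ ≢ j
      apart₁₃ j∈ = new-apart P₁#rest (∈-map⁺ ι₂ q₁∈) (∈-++⁺ʳ Q₁ (∈-++⁺ʳ P₂ (∈-++⁺ʳ Q₂ (∈-++⁺ˡ (in₃ j∈)))))
      apart₂₃ : ∀ {i j} → i ∈ r₂ ∷ R₂ → j ∈ r₃ ∷ R₃ → i ≢ j
      apart₂₃ i∈ j∈ = new-apart P₂#rest (in₂ i∈) (∈-++⁺ʳ Q₂ (∈-++⁺ˡ (in₃ j∈)))
      r₂≢q₂ : r₂ ≢ q₂
      r₂≢q₂ = nb-apart (λ (m , m′) → Q₁#rest (m , ∈-++⁺ʳ P₂ (∈-++⁺ˡ m′))) (Arc-end∈ G A₁) (Arc-start∈ G A₂)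
      r₃≢q₃ : r₃ ≢ q₃
      r₃≢q₃ refl = Q₂#rest (pt∈⇒ι₁∈ (s₂ ∷ S₂) (subst (_∈ map pt (s₂ ∷ S₂)) exit₃ (Arc-end∈ G A₂)) ,
                            ∈-++⁺ʳ P₃ (here refl))
      distinct : Unique (q₁ ∷ r₂ ∷ q₂ ∷ r₃ ∷ q₃ ∷ [])
      distinct = (apart₁₂ (here refl) ∷ apart₁₂ q₂∈ ∷ apart₁₃ (here refl) ∷ apart₁₃ q₃∈ ∷ [])
               ∷ (r₂≢q₂ ∷ apart₂₃ (here refl) (here refl) ∷ apart₂₃ (here refl) q₃∈ ∷ [])
               ∷ (apart₂₃ q₂∈ (here refl) ∷ apart₂₃ q₂∈ q₃∈ ∷ [])
               ∷ (r₃≢q₃ ∷ [])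
               ∷ [] ∷ []

    alternating-length : ∀ {zs} → Alternating zs → IsCycle G′ zs → length zs ≤ c + 3
    alternating-length (one-run r R s S) = one-run-length r R s S
    alternating-length (two-runs r₁ R₁ s₁ S₁ r₂ R₂ s₂ S₂) = two-runs-length r₁ R₁ s₁ S₁ r₂ R₂ s₂ S₂
    alternating-length (three-runs r₁ R₁ s₁ S₁ r₂ R₂ s₂ S₂ r₃ R₃ s₃ T) cyc =
      ⊥-elim (three-runs-impossible r₁ R₁ s₁ S₁ r₂ R₂ s₂ S₂ r₃ R₃ s₃ T cyc)

    length-from-old : ∀ s zs → IsCycle G′ (inj₁ s ∷ zs) → length (inj₁ s ∷ zs) ≤ c + 3
    length-from-old s zs cyc with spanOld zs
    ... | all-old S = ≤-trans (old-cycle-length bound (s ∷ S) cyc) (m≤m+n c 3)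
    ... | then-new S i T =
      subst (_≤ c + 3) (length-++-comm (inj₂ i ∷ T) (map ι₁ (s ∷ S)))
        (alternating-length (alternating i (T ++ map ι₁ (s ∷ S)) (LastOld-++⁺ (inj₂ i ∷ T) (LastOld-olds s S)))
                            (IsCycle-rotate G′ (inj₁ s) (map ι₁ S) (inj₂ i) T cyc))

    length-from-new : ∀ i zs → IsCycle G′ (inj₂ i ∷ zs) → length (inj₂ i ∷ zs) ≤ c + 3
    length-from-new i zs cyc@(_ , u , _) with spanNew zs
    ... | all-new R = ≤-trans (Unique-length-≤ u (news⊆ (i ∷ R))) (+-monoˡ-≤ 3 (≤-trans (s≤s z≤n) c≥3))
    ... | then-old R s T =
      subst (_≤ c + 3) (length-++-comm (inj₁ s ∷ T) (map ι₂ (i ∷ R)))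
        (length-from-old s (T ++ inj₂ i ∷ map ι₂ R) (IsCycle-rotate G′ (inj₂ i) (map ι₂ R) (inj₁ s) T cyc))

    cycle-length : CyclesAtMost G′ (c + 3)
    cycle-length (inj₁ s ∷ zs) = length-from-old s zs
    cycle-length (inj₂ i ∷ zs) = length-from-new i zs

  K₄-clique : ∀ p → InClique4 G′ (inj₂ p)
  K₄-clique p = ι₂ , (λ _ _ i≢j → i≢j) , p , refl

  circumference-blowUp : ∀ c → Circumference G c → InLongestCycle G v → InClique4 G v →
                         Circumference G′ (c + 3) × Σ (V G′) λ v′ → InLongestCycle G′ v′ × InClique4 G′ v′
  circumference-blowUp c circ@((_ , cyc₀ , refl) , bound) (_ , longest@(cyc , _) , v∈xs) clique
    with IsCycle-through G cyc v∈xs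
  ... | _ , cycY , lenY with cycle-through-v cycY
  ... | p , zs , cyc′ , len′ , p∈zs =
    ((zs , cyc′ , zs-length) , upper) ,
    inj₂ p , (zs , (cyc′ , λ ys cys → subst (length ys ≤_) (sym zs-length) (upper ys cys)) , p∈zs) , K₄-clique p
    where
    upper : CyclesAtMost G′ (c + 3)
    upper = CycleBound.cycle-length bound (IsCycle⇒3≤length G cyc₀) clique
    zs-length : length zs ≡ c + 3
    zs-length = trans len′ (trans (cong (3 +_) (trans lenY (LongestCycle-length G circ longest))) (+-comm 3 c))

lemma2 : (G : Graph) (n : ℕ) → (Fin n ↔ V G) → (v : V G) (e : NbhdEnum G v 4) →
    DHT G →
      DHT (blowUp G v e)
      × ((c : ℕ) → Circumference G c → InLongestCycle G v → InClique4 G v →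
          Circumference (blowUp G v e) (c + 3)
          × Σ (V (blowUp G v e)) (λ v' → InLongestCycle (blowUp G v e) v' × InClique4 (blowUp G v e) v'))
lemma2 G _ _ v e dht = DHT-blowUp dht , circumference-blowUp
  where open BlowUp G v e
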